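{- Let $\mathcal{K}=(S,s_\mathit{init},\mathbb{D},\kappa,\ell)$ be a Kripke structure over $\mathit{AP}$ and let $\varphi=\forall\pi_1.\exists\pi_2.\forall\pi_3\ldots\forall\pi_{2n-1}.\exists\pi_{2n}.\psi$ be a HyperLTL formula over $\mathit{AP}$ whose quantifier prefix strictly alternates (universal at odd indices, existential at even indices). Let $\vec{\Xi}=\{\Xi_{2i-1}\}_{i=1}^n$ be a prophecy family and $P$ a corresponding set of prophecy variables. Then $\mathcal{K}\models\varphi$ if and only if $\mathcal{K}^P\models\varphi^{P,\vec{\Xi}}$.
   Context: A Kripke structure over $\mathit{AP}$ is $\mathcal{K}=(S,s_\mathit{init},\mathbb{D},\kappa,\ell)$ with finite $S$, initial state $s_\mathit{init}\notin S$, finite directions $\mathbb{D}$, $\kappa:(S\uplus\{s_\mathit{init}\})\times\mathbb{D}\to S$, $\ell:(S\uplus\{s_\mathit{init}\})\to2^{\mathit{AP}}$; paths start at $s_\mathit{init}$ and each step move to $\kappa(\text{current},d)$ for some $d$; $\mathit{Traces}(\mathcal{K})$ is the set of label sequences of paths. A HyperLTL formula $\mathds{Q}_1\pi_1\ldots\mathds{Q}_N\pi_N.\psi$ has body $\psi$ an LTL formula (operators $\neg,\land,\mathsf{X},\mathsf{U}$; $\mathsf{G},\mathsf{F}$ derived) over indexed propositions $a_{\pi_i}$, where $a_{\pi_i}$ holds at time $j$ iff $a$ belongs to the $j$-th letter of the trace assigned to $\pi_i$; $\mathcal{K}\models\varphi$ is the standard first-order semantics with quantifiers over $\mathit{Traces}(\mathcal{K})$.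 A prophecy family is $\vec{\Xi}=\{\Xi_{2i-1}\}_{i=1}^n$ where each $\Xi_{2i-1}$ is a finite set of LTL formulas over indexed propositions $a_{\pi_j}$ with $a\in\mathit{AP}$ and $j\in\{1,\ldots,2i-1\}$. A corresponding set of prophecy variables is a finite set $P$ of fresh atomic propositions ($P\cap\mathit{AP}=\emptyset$) containing, for each $1\le i\le n$ and $\xi\in\Xi_{2i-1}$, a prophecy variable $p^\xi\in P$ (distinct formulas receiving distinct variables). $\mathcal{K}^P$ is the Kripke structure over $\mathit{AP}\uplus P$ given by $(S\times2^P,s_\mathit{init},\mathbb{D}\times2^P,\kappa^P,\ell^P)$ with $\kappa^P(s_\mathit{init},(d,A))=(\kappa(s_\mathit{init},d),A)$, $\kappa^P((s,A'),(d,A))=(\kappa(s,d),A)$, $\ell^P(s_\mathit{init})=\ell(s_\mathit{init})$ and $\ell^P(s,A)=\ell(s)\cup A$. $\varphi^{P,\vec{\Xi}}:=\forall\pi_1.\exists\pi_2.\forall\pi_3\ldots\forall\pi_{2n-1}.\exists\pi_{2n}.\Big(\mathsf{X}\mathsf{G}\bigwedge_{i=1}^n\bigwedge_{\xi\in\Xi_{2i-1}}\big((p^\xi)_{\pi_{2i-1}}\leftrightarrow\xi\big)\Big)\to\psi$, a HyperLTL formula over $\mathit{AP}\uplus P$. -}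

module Defs where

open import Level using (0ℓ)
open import Data.Nat using (ℕ; zero; suc; _≤_; _<_)
open import Data.Fin using (Fin; zero; suc; toℕ)
open import Data.Bool using (Bool; true; false)
open import Data.Maybe using (Maybe; nothing; just)
open import Data.Product using (Σ; ∃; _×_; _,_)
open import Data.Sum using (_⊎_; inj₁; inj₂; [_,_])
open import Data.Unit using (⊤)
open import Data.List using (List; []; _∷_; foldr; map)
open import Data.Vec using (Vec; []; _∷_)
open import Data.List.Membership.Propositional using (_∈_)
open import Relation.Nullary using (¬_)
open import Relation.Binary.PropositionalEquality using (_≡_)
open import Function.Bundles using (_↔_)

Finite : Set → Set
Finite X = Σ ℕ λ k → X ↔ Fin k

Label : Set → Set
Label AP = AP → Bool

Trace : Set → Set
Trace AP = ℕ → Label AP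

-- States of the structure are  Maybe S : nothing is s_init (∉ S).
record Kripke (AP : Set) : Set₁ where
  field
    S : Set
    D : Set
    κ : Maybe S → D → S
    ℓ : Maybe S → Label AP

FiniteKripke : {AP : Set} → Kripke AP → Set
FiniteKripke K = Finite (Kripke.S K) × Finite (Kripke.D K)

module _ {AP : Set} (K : Kripke AP) where
  open Kripke K

  stateAt : (ℕ → D) → ℕ → Maybe S
  stateAt ds zero = nothing
  stateAt ds (suc j) = just (κ (stateAt ds j) (ds j))

  pathTrace : (ℕ → D) → Trace AP
  pathTrace ds j = ℓ (stateAt ds j)

  InTraces : Trace AP → Set
  InTraces t = Σ (ℕ → D) λ ds → ∀ j a → t j a ≡ pathTrace ds j a

infixr 6 _∧ₗ_
infixr 5 _Uₗ_

data LTL (At : Set) : Set where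
  ttₗ  : LTL At
  atom : At → LTL At
  ¬ₗ_  : LTL At → LTL At
  _∧ₗ_ : LTL At → LTL At → LTL At
  Xₗ   : LTL At → LTL At
  _Uₗ_ : LTL At → LTL At → LTL At

mapLTL : {A B : Set} → (A → B) → LTL A → LTL B
mapLTL f ttₗ = ttₗ
mapLTL f (atom a) = atom (f a)
mapLTL f (¬ₗ φ) = ¬ₗ mapLTL f φ
mapLTL f (φ ∧ₗ ψ) = mapLTL f φ ∧ₗ mapLTL f ψ
mapLTL f (Xₗ φ) = Xₗ (mapLTL f φ)
mapLTL f (φ Uₗ ψ) = mapLTL f φ Uₗ mapLTL f ψ

Sat : {At : Set} → (ℕ → At → Bool) → ℕ → LTL At → Set
Sat ρ j ttₗ = ⊤
Sat ρ j (atom a) = ρ j a ≡ true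
Sat ρ j (¬ₗ φ) = ¬ Sat ρ j φ
Sat ρ j (φ ∧ₗ ψ) = Sat ρ j φ × Sat ρ j ψ
Sat ρ j (Xₗ φ) = Sat ρ (suc j) φ
Sat ρ j (φ Uₗ ψ) =
  Σ ℕ λ k → j ≤ k × Sat ρ k ψ × (∀ l → j ≤ l → l < k → Sat ρ l φ)

_⇒ₗ_ : {At : Set} → LTL At → LTL At → LTL At
φ ⇒ₗ ψ = ¬ₗ (φ ∧ₗ ¬ₗ ψ)

_⇔ₗ_ : {At : Set} → LTL At → LTL At → LTL At
φ ⇔ₗ ψ = (φ ⇒ₗ ψ) ∧ₗ (ψ ⇒ₗ φ)

Fₗ : {At : Set} → LTL At → LTL At
Fₗ φ = ttₗ Uₗ φ

Gₗ : {At : Set} → LTL At → LTL At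
Gₗ φ = ¬ₗ Fₗ (¬ₗ φ)

conjList : {At : Set} → List (LTL At) → LTL At
conjList = foldr _∧ₗ_ ttₗ

conjFin : {At : Set} {n : ℕ} → (Fin n → LTL At) → LTL At
conjFin {n = zero} f = ttₗ
conjFin {n = suc n} f = f zero ∧ₗ conjFin (λ i → f (suc i))

AllAtoms : {At : Set} → (At → Set) → LTL At → Set
AllAtoms Q ttₗ = ⊤
AllAtoms Q (atom a) = Q a
AllAtoms Q (¬ₗ φ) = AllAtoms Q φ
AllAtoms Q (φ ∧ₗ ψ) = AllAtoms Q φ × AllAtoms Q ψ
AllAtoms Q (Xₗ φ) = AllAtoms Q φ
AllAtoms Q (φ Uₗ ψ) = AllAtoms Q φ × AllAtoms Q ψ

-- HyperLTL
-- Trace variable π_{i+1} is the index i : Fin N; atom (a , i) is a_{π_{i+1}}.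

data Quant : Set where
  ∀q ∃q : Quant

record HyperLTL (AP : Set) : Set where
  field
    N      : ℕ
    prefix : Vec Quant N
    body   : LTL (AP × Fin N)

extEnv : {AP : Set} {N : ℕ} → Trace AP → (Fin N → Trace AP) → Fin (suc N) → Trace AP
extEnv t Π zero = t
extEnv t Π (suc i) = Π i

-- quantifier prefix: the first quantifier binds index zero
QSat : {AP : Set} {N : ℕ} → Kripke AP → Vec Quant N →
       ((Fin N → Trace AP) → Set) → Set
QSat K [] B = B (λ ())
QSat K (∀q ∷ qs) B = ∀ t → InTraces K t → QSat K qs (λ Π → B (extEnv t Π))
QSat K (∃q ∷ qs) B = Σ (Trace _) λ t → InTraces K t × QSat K qs (λ Π → B (extEnv t Π))

indexedWord : {AP : Set} {N : ℕ} → (Fin N → Trace AP) → ℕ → AP × Fin N → Bool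
indexedWord Π j (a , i) = Π i j a

_⊨_ : {AP : Set} → Kripke AP → HyperLTL AP → Set
K ⊨ φ = QSat K (HyperLTL.prefix φ) (λ Π → Sat (indexedWord Π) 0 (HyperLTL.body φ))

double : ℕ → ℕ
double zero = zero
double (suc n) = suc (suc (double n))

altPrefix : (n : ℕ) → Vec Quant (double n)
altPrefix zero = []
altPrefix (suc n) = ∀q ∷ ∃q ∷ altPrefix n

altFormula : {AP : Set} (n : ℕ) → LTL (AP × Fin (double n)) → HyperLTL AP
altFormula n ψ = record { N = double n ; prefix = altPrefix n ; body = ψ }

-- for i : Fin n (meaning i+1 ∈ {1..n}), the index of π_{2(i+1)-1}
oddVar : {n : ℕ} → Fin n → Fin (double n)
oddVar zero = zero
oddVar (suc i) = suc (suc (oddVar i))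

-- Ξ i is the finite set Ξ_{2(i+1)-1}, given as a list
ProphecyFamily : Set → ℕ → Set
ProphecyFamily AP n = Fin n → List (LTL (AP × Fin (double n)))

IsProphecyFamily : {AP : Set} {n : ℕ} → ProphecyFamily AP n → Set
IsProphecyFamily {n = n} Ξ =
  ∀ (i : Fin n) ξ → ξ ∈ Ξ i →
  AllAtoms (λ { (a , j) → toℕ j ≤ toℕ (oddVar i) }) ξ

-- pv ξ is the prophecy variable p^ξ ∈ P = Fin m; distinct formulas of the
-- family get distinct variables
IsProphecyVars : {AP : Set} {n m : ℕ} → ProphecyFamily AP n →
                 (LTL (AP × Fin (double n)) → Fin m) → Set
IsProphecyVars {n = n} Ξ pv =
  ∀ (i i' : Fin n) ξ ξ' → ξ ∈ Ξ i → ξ' ∈ Ξ i' → pv ξ ≡ pv ξ' → ξ ≡ ξ'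

KP : {AP : Set} → Kripke AP → (m : ℕ) → Kripke (AP ⊎ Fin m)
KP {AP} K m = record { S = S × Label (Fin m) ; D = D × Label (Fin m) ; κ = κP ; ℓ = ℓP }
  where
  open Kripke K
  κP : Maybe (S × Label (Fin m)) → D × Label (Fin m) → S × Label (Fin m)
  κP nothing (d , A) = (κ nothing d , A)
  κP (just (s , A')) (d , A) = (κ (just s) d , A)
  ℓP : Maybe (S × Label (Fin m)) → Label (AP ⊎ Fin m)
  ℓP nothing = [ ℓ nothing , (λ _ → false) ]
  ℓP (just (s , A)) = [ ℓ (just s) , A ]

liftAP : {AP : Set} {N m : ℕ} → LTL (AP × Fin N) → LTL ((AP ⊎ Fin m) × Fin N)
liftAP = mapLTL (λ { (a , i) → (inj₁ a , i) })

prophecyFormula : {AP : Set} {n m : ℕ} → ProphecyFamily AP n →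
  (LTL (AP × Fin (double n)) → Fin m) → LTL (AP × Fin (double n)) →
  HyperLTL (AP ⊎ Fin m)
prophecyFormula {n = n} Ξ pv ψ =
  record { N = double n ; prefix = altPrefix n
         ; body = Xₗ (Gₗ constraint) ⇒ₗ liftAP ψ }
  where
  constraint = conjFin (λ i → conjList
    (map (λ ξ → atom (inj₂ (pv ξ) , oddVar i) ⇔ₗ liftAP ξ) (Ξ i)))

{-# OPTIONS --safe #-}
-- Erasing the prophecy labels maps traces of K^P onto traces of K, and every trace of K lifts to
-- K^P with any prophecy labels after time 0. From K to K^P, answer each universal trace of K^P
-- through its erasure and lift the existential answers of K with arbitrary prophecies; ψ does not
-- mention P, so it transfers. From K^P to K, lift the universal trace π_{2i-1} by setting p^ξ at
-- time j ≥ 1 to the truth value of ξ at j: since ξ only mentions π_1 … π_{2i-1}, which are all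
-- chosen by then, the labelling is causal and satisfies the prophecy constraint, so the implication
-- of φ^{P,Ξ} yields ψ. The truth values are chosen by excluded middle.
module Submission where

open import Defs
open import Level using (0ℓ)
open import Data.Nat using (ℕ; zero; suc; _≤_; _<_; z≤n; s≤s)
open import Data.Fin using (Fin; zero; suc; toℕ)
open import Data.Bool using (Bool; true; false)
open import Data.Bool.Properties using (T-≡)
open import Data.Maybe using (Maybe; nothing; just) renaming (map to mapMaybe)
open import Data.Product using (Σ; _×_; _,_; proj₁; proj₂)
open import Data.Product.Function.NonDependent.Propositional using (_×-⇔_)
open import Data.Sum using (_⊎_; inj₁; inj₂; [_,_])
open import Data.List using (map)
open import Data.List.Membership.Propositional using (_∈_)
open import Data.List.Relation.Unary.All as All using (All; []; _∷_)
open import Data.List.Relation.Unary.All.Properties using (map⁺)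
open import Relation.Nullary using (does)
open import Relation.Nullary.Decidable using (does-⇔; dec-true; toWitness; isYes≗does)
open import Relation.Binary.PropositionalEquality using (_≡_; refl; sym; trans; cong; subst)
open import Function using (_∘_)
open import Function.Bundles using (_⇔_; mk⇔; Equivalence)
open import Function.Properties.Equivalence using () renaming (refl to ⇔-refl; sym to ⇔-sym)
open import Function.Related.TypeIsomorphisms using (¬-cong-⇔)
open import Function.Related.Propositional using (module EquationalReasoning)
open import Axiom.ExcludedMiddle using (ExcludedMiddle)
open import Axiom.DoubleNegationElimination using (em⇒dne)

open Equivalence using (to; from)

Until : (ℕ → Set) → (ℕ → Set) → ℕ → Set
Until A B j = Σ ℕ λ k → j ≤ k × B k × (∀ l → j ≤ l → l < k → A l)

Until-cong : ∀ {A A' B B' : ℕ → Set} →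
  (∀ l → A l ⇔ A' l) → (∀ k → B k ⇔ B' k) → ∀ j → Until A B j ⇔ Until A' B' j
Until-cong A⇔ B⇔ j = mk⇔
  (λ (k , j≤k , Bk , A<k) → k , j≤k , to (B⇔ k) Bk , λ l j≤l l<k → to (A⇔ l) (A<k l j≤l l<k))
  (λ (k , j≤k , Bk , A<k) → k , j≤k , from (B⇔ k) Bk , λ l j≤l l<k → from (A⇔ l) (A<k l j≤l l<k))

Sat-cong-AllAtoms : ∀ {At : Set} {Q : At → Set} {ρ ρ' : ℕ → At → Bool} →
  (∀ k a → Q a → ρ k a ≡ ρ' k a) → ∀ φ → AllAtoms Q φ → ∀ j → Sat ρ j φ ⇔ Sat ρ' j φ
Sat-cong-AllAtoms h ttₗ _ j = ⇔-refl
Sat-cong-AllAtoms h (atom a) q j = mk⇔ (trans (sym (h j a q))) (trans (h j a q))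
Sat-cong-AllAtoms h (¬ₗ φ) q j = ¬-cong-⇔ (Sat-cong-AllAtoms h φ q j)
Sat-cong-AllAtoms h (φ ∧ₗ ψ) (q , q') j =
  Sat-cong-AllAtoms h φ q j ×-⇔ Sat-cong-AllAtoms h ψ q' j
Sat-cong-AllAtoms h (Xₗ φ) q j = Sat-cong-AllAtoms h φ q (suc j)
Sat-cong-AllAtoms h (φ Uₗ ψ) (q , q') =
  Until-cong (Sat-cong-AllAtoms h φ q) (Sat-cong-AllAtoms h ψ q')

Sat-mapLTL : ∀ {A B : Set} {f : A → B} {ρ : ℕ → B → Bool} {ρ' : ℕ → A → Bool} →
  (∀ k a → ρ k (f a) ≡ ρ' k a) → ∀ φ j → Sat ρ j (mapLTL f φ) ⇔ Sat ρ' j φ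
Sat-mapLTL h ttₗ j = ⇔-refl
Sat-mapLTL h (atom a) j = mk⇔ (trans (sym (h j a))) (trans (h j a))
Sat-mapLTL h (¬ₗ φ) j = ¬-cong-⇔ (Sat-mapLTL h φ j)
Sat-mapLTL h (φ ∧ₗ ψ) j = Sat-mapLTL h φ j ×-⇔ Sat-mapLTL h ψ j
Sat-mapLTL h (Xₗ φ) j = Sat-mapLTL h φ (suc j)
Sat-mapLTL h (φ Uₗ ψ) = Until-cong (Sat-mapLTL h φ) (Sat-mapLTL h ψ)

module _ {At : Set} {ρ : ℕ → At → Bool} where

  Sat-Gₗ-intro : ∀ φ {j} → (∀ k → j ≤ k → Sat ρ k φ) → Sat ρ j (Gₗ φ)
  Sat-Gₗ-intro φ always (k , j≤k , ¬φk , _) = ¬φk (always k j≤k)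

  Sat-⇔ₗ-intro : ∀ φ ψ {j} → Sat ρ j φ ⇔ Sat ρ j ψ → Sat ρ j (φ ⇔ₗ ψ)
  Sat-⇔ₗ-intro φ ψ φ⇔ψ =
    (λ (φj , ¬ψj) → ¬ψj (to φ⇔ψ φj)) , (λ (ψj , ¬φj) → ¬φj (from φ⇔ψ ψj))

  Sat-conjList-intro : ∀ {φs j} → All (Sat ρ j) φs → Sat ρ j (conjList φs)
  Sat-conjList-intro [] = _
  Sat-conjList-intro (holds ∷ rest) = holds , Sat-conjList-intro rest

  Sat-conjFin-intro : ∀ {N j} {f : Fin N → LTL At} → (∀ i → Sat ρ j (f i)) → Sat ρ j (conjFin f)
  Sat-conjFin-intro {zero} _ = _
  Sat-conjFin-intro {suc N} each = each zero , Sat-conjFin-intro (each ∘ suc)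

Assignment : Set → ℕ → Set
Assignment X N = Fin N → Trace X

AgreeUpTo : ∀ {X N} → ℕ → Assignment X N → Assignment X N → Set
AgreeUpTo c Π₁ Π₂ = ∀ k → toℕ k ≤ c → ∀ j a → Π₁ k j a ≡ Π₂ k j a

AgreeUpTo-extEnv² : ∀ {X N c} {t t₂ : Trace X} {Π₁ Π₂ : Assignment X N} → AgreeUpTo c Π₁ Π₂ →
  AgreeUpTo (suc (suc c)) (extEnv t (extEnv t₂ Π₁)) (extEnv t (extEnv t₂ Π₂))
AgreeUpTo-extEnv² agree zero _ j a = refl
AgreeUpTo-extEnv² agree (suc zero) _ j a = refl
AgreeUpTo-extEnv² agree (suc (suc k)) (s≤s (s≤s k≤c)) = agree k k≤c

AgreeUpTo-head : ∀ {X N} {t : Trace X} {Π : Assignment X N} → AgreeUpTo 0 (λ _ → t) (extEnv t Π)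
AgreeUpTo-head zero z≤n j a = refl

module _ {AP : Set} {m : ℕ} where

  eraseProphecies : Trace (AP ⊎ Fin m) → Trace AP
  eraseProphecies t j a = t j (inj₁ a)

  addProphecies : Trace AP → (ℕ → Label (Fin m)) → Trace (AP ⊎ Fin m)
  addProphecies t A zero = [ t zero , (λ _ → false) ]
  addProphecies t A (suc j) = [ t (suc j) , A (suc j) ]

  ErasesTo : Trace (AP ⊎ Fin m) → Trace AP → Set
  ErasesTo t' t = ∀ j a → t' j (inj₁ a) ≡ t j a

  PointwiseErasesTo : ∀ {N} → Assignment (AP ⊎ Fin m) N → Assignment AP N → Set
  PointwiseErasesTo Π' Π = ∀ i → ErasesTo (Π' i) (Π i)

  addProphecies-erases : ∀ t A → ErasesTo (addProphecies t A) t
  addProphecies-erases t A zero a = refl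
  addProphecies-erases t A (suc j) a = refl

  extEnv-ErasesTo : ∀ {N t' t} {Π' : Assignment (AP ⊎ Fin m) N} {Π : Assignment AP N} →
    ErasesTo t' t → PointwiseErasesTo Π' Π → PointwiseErasesTo (extEnv t' Π') (extEnv t Π)
  extEnv-ErasesTo e r zero = e
  extEnv-ErasesTo e r (suc i) = r i

  Sat-liftAP : ∀ {N} {Π' : Assignment (AP ⊎ Fin m) N} {Π : Assignment AP N} →
    PointwiseErasesTo Π' Π → ∀ φ j → Sat (indexedWord Π') j (liftAP φ) ⇔ Sat (indexedWord Π) j φ
  Sat-liftAP r = Sat-mapLTL λ k (a , i) → r i k a

Oracle : Set → ℕ → ℕ → Set
Oracle AP m n = Fin n → Assignment AP (double n) → ℕ → Label (Fin m)

Causal : ∀ {AP m n} → Oracle AP m n → Set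
Causal o = ∀ i {Π₁ Π₂} → AgreeUpTo (toℕ (oddVar i)) Π₁ Π₂ → ∀ j p → o i Π₁ j p ≡ o i Π₂ j p

FollowsOracle : ∀ {AP m n} → Oracle AP m n →
  Assignment AP (double n) → Assignment (AP ⊎ Fin m) (double n) → Set
FollowsOracle o Π Π' = ∀ i j p → Π' (oddVar i) (suc j) (inj₂ p) ≡ o i Π (suc j) p

module _ {AP : Set} (K : Kripke AP) (m : ℕ) where
  open Kripke K
  open Kripke (KP K m) using () renaming (κ to κᴾ; ℓ to ℓᴾ)

  eraseState : Maybe (S × Label (Fin m)) → Maybe S
  eraseState = mapMaybe proj₁

  κᴾ-step : ∀ s d A → κᴾ s (d , A) ≡ (κ (eraseState s) d , A)
  κᴾ-step nothing d A = refl
  κᴾ-step (just _) d A = refl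

  ℓᴾ-erase : ∀ s a → ℓᴾ s (inj₁ a) ≡ ℓ (eraseState s) a
  ℓᴾ-erase nothing a = refl
  ℓᴾ-erase (just _) a = refl

  stateAt-erase : ∀ ds j → eraseState (stateAt (KP K m) ds j) ≡ stateAt K (proj₁ ∘ ds) j
  stateAt-erase ds zero = refl
  stateAt-erase ds (suc j) = cong just (trans
    (cong proj₁ (κᴾ-step (stateAt (KP K m) ds j) (proj₁ (ds j)) (proj₂ (ds j))))
    (cong (λ s → κ s (proj₁ (ds j))) (stateAt-erase ds j)))

  pathTrace-erase : ∀ ds j a → pathTrace (KP K m) ds j (inj₁ a) ≡ pathTrace K (proj₁ ∘ ds) j a
  pathTrace-erase ds j a =
    trans (ℓᴾ-erase (stateAt (KP K m) ds j) a) (cong (λ s → ℓ s a) (stateAt-erase ds j))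

  erase-InTraces : ∀ {t'} → InTraces (KP K m) t' → InTraces K (eraseProphecies t')
  erase-InTraces (ds , t'≡) = proj₁ ∘ ds , λ j a → trans (t'≡ j (inj₁ a)) (pathTrace-erase ds j a)

  add-InTraces : ∀ {t} A → InTraces K t → InTraces (KP K m) (addProphecies t A)
  add-InTraces {t} A (ds , t≡) = dsᴾ , matches
    where
    dsᴾ : ℕ → D × Label (Fin m)
    dsᴾ j = ds j , A (suc j)
    matches : ∀ j x → addProphecies t A j x ≡ pathTrace (KP K m) dsᴾ j x
    matches j (inj₁ a) =
      trans (addProphecies-erases t A j a) (trans (t≡ j a) (sym (pathTrace-erase dsᴾ j a)))
    matches zero (inj₂ p) = refl
    matches (suc j) (inj₂ p) =
      sym (cong (λ s → proj₂ s p) (κᴾ-step (stateAt (KP K m) dsᴾ j) (ds j) (A (suc j))))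

  QSat-toKP : ∀ n {B : Assignment AP (double n) → Set}
                  {B' : Assignment (AP ⊎ Fin m) (double n) → Set} →
    (∀ {Π Π'} → PointwiseErasesTo Π' Π → B Π → B' Π') →
    QSat K (altPrefix n) B → QSat (KP K m) (altPrefix n) B'
  QSat-toKP zero transfer holds = transfer (λ ()) holds
  QSat-toKP (suc n) transfer holds t' t'∈ with holds (eraseProphecies t') (erase-InTraces t'∈)
  ... | t₂ , t₂∈ , rest =
    addProphecies t₂ noProphecy , add-InTraces noProphecy t₂∈ ,
    QSat-toKP n (λ r → transfer (extEnv-ErasesTo (λ _ _ → refl)
                                  (extEnv-ErasesTo (addProphecies-erases t₂ noProphecy) r)))
                rest
    where
    noProphecy : ℕ → Label (Fin m)
    noProphecy _ _ = false

  QSat-fromKP : ∀ n {B : Assignment AP (double n) → Set}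
                    {B' : Assignment (AP ⊎ Fin m) (double n) → Set} →
    (o : Oracle AP m n) → Causal o →
    (∀ {Π Π'} → PointwiseErasesTo Π' Π → FollowsOracle o Π Π' → B' Π' → B Π) →
    QSat (KP K m) (altPrefix n) B' → QSat K (altPrefix n) B
  QSat-fromKP zero o causal transfer holds = transfer (λ ()) (λ ()) holds
  -- When π₁ is chosen nothing else is known yet; by causality the padding λ _ → t is irrelevant.
  QSat-fromKP (suc n) o causal transfer holds t t∈
    with holds (addProphecies t (o zero (λ _ → t))) (add-InTraces _ t∈)
  ... | t₂' , t₂'∈ , rest =
    eraseProphecies t₂' , erase-InTraces t₂'∈ ,
    QSat-fromKP n o₊ (λ i agree → causal (suc i) (AgreeUpTo-extEnv² agree))
      (λ r f → transfer (extEnv-ErasesTo (addProphecies-erases t _) (extEnv-ErasesTo (λ _ _ → refl) r))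
                        (follows f))
      rest
    where
    o₊ : Oracle AP m n
    o₊ i Π = o (suc i) (extEnv t (extEnv (eraseProphecies t₂') Π))
    follows : ∀ {Π Π'} → FollowsOracle o₊ Π Π' →
      FollowsOracle o (extEnv t (extEnv (eraseProphecies t₂') Π))
                      (extEnv (addProphecies t (o zero (λ _ → t))) (extEnv t₂' Π'))
    follows f zero j p = causal zero AgreeUpTo-head (suc j) p
    follows f (suc i) = f i

module _ (em : ExcludedMiddle 0ℓ) {AP : Set} {n m : ℕ}
         (Ξ : ProphecyFamily AP n) (pv : LTL (AP × Fin (double n)) → Fin m) where

  prophecyConstraint : LTL ((AP ⊎ Fin m) × Fin (double n))
  prophecyConstraint = conjFin (λ i → conjList
    (map (λ ξ → atom (inj₂ (pv ξ) , oddVar i) ⇔ₗ liftAP ξ) (Ξ i)))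

  Predicts : Fin n → Assignment AP (double n) → ℕ → Fin m → Set
  Predicts i Π j p =
    Σ (LTL (AP × Fin (double n))) λ ξ → ξ ∈ Ξ i × pv ξ ≡ p × Sat (indexedWord Π) j ξ

  Predicts-pv : IsProphecyVars Ξ pv → ∀ {i ξ Π j} → ξ ∈ Ξ i →
    Predicts i Π j (pv ξ) ⇔ Sat (indexedWord Π) j ξ
  Predicts-pv isP {i} {ξ} {Π} {j} ξ∈ = mk⇔
    (λ (ξ' , ξ'∈ , pv≡ , holds) → subst (Sat (indexedWord Π) j) (isP i i ξ' ξ ξ'∈ ξ∈ pv≡) holds)
    (λ holds → ξ , ξ∈ , refl , holds)

  prophecyOracle : Oracle AP m n
  prophecyOracle i Π j p = does (em {Predicts i Π j p})

  prophecyOracle≡true : ∀ {i Π j p} → prophecyOracle i Π j p ≡ true ⇔ Predicts i Π j p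
  prophecyOracle≡true =
    mk⇔ (λ e → toWitness {a? = em} (from T-≡ (trans (isYes≗does em) e))) (dec-true em)

  prophecyOracle-causal : IsProphecyFamily Ξ → Causal prophecyOracle
  prophecyOracle-causal isΞ i {Π₁} {Π₂} agree j p = does-⇔ (mk⇔
    (λ (ξ , ξ∈ , pv≡ , holds) → ξ , ξ∈ , pv≡ , to (same ξ ξ∈) holds)
    (λ (ξ , ξ∈ , pv≡ , holds) → ξ , ξ∈ , pv≡ , from (same ξ ξ∈) holds)) em em
    where
    same : ∀ ξ → ξ ∈ Ξ i → Sat (indexedWord Π₁) j ξ ⇔ Sat (indexedWord Π₂) j ξ
    same ξ ξ∈ = Sat-cong-AllAtoms (λ { k (a , l) l≤ → agree l l≤ k a }) ξ (isΞ i ξ ξ∈) j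

  prophecyConstraint-holds : IsProphecyVars Ξ pv →
    ∀ {Π Π'} → PointwiseErasesTo Π' Π → FollowsOracle prophecyOracle Π Π' →
    ∀ j → Sat (indexedWord Π') (suc j) prophecyConstraint
  prophecyConstraint-holds isP {Π} {Π'} r f j =
    Sat-conjFin-intro λ i → Sat-conjList-intro (map⁺ (All.tabulate λ {ξ} ξ∈ →
      Sat-⇔ₗ-intro (atom (inj₂ (pv ξ) , oddVar i)) (liftAP ξ) (correct i ξ∈)))
    where
    open EquationalReasoning
    correct : ∀ i {ξ} → ξ ∈ Ξ i →
      Sat (indexedWord Π') (suc j) (atom (inj₂ (pv ξ) , oddVar i))
        ⇔ Sat (indexedWord Π') (suc j) (liftAP ξ)
    correct i {ξ} ξ∈ = begin
      Π' (oddVar i) (suc j) (inj₂ (pv ξ)) ≡ true    ≡⟨ cong (_≡ true) (f i j (pv ξ)) ⟩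
      prophecyOracle i Π (suc j) (pv ξ) ≡ true      ∼⟨ prophecyOracle≡true ⟩
      Predicts i Π (suc j) (pv ξ)                    ∼⟨ Predicts-pv isP ξ∈ ⟩
      Sat (indexedWord Π) (suc j) ξ                  ∼⟨ ⇔-sym (Sat-liftAP r ξ (suc j)) ⟩
      Sat (indexedWord Π') (suc j) (liftAP ξ)        ∎

  prophecyFormula-fromKP : IsProphecyVars Ξ pv → ∀ ψ {Π Π'} →
    PointwiseErasesTo Π' Π → FollowsOracle prophecyOracle Π Π' →
    Sat (indexedWord Π') 0 (Xₗ (Gₗ prophecyConstraint) ⇒ₗ liftAP ψ) → Sat (indexedWord Π) 0 ψ
  prophecyFormula-fromKP isP ψ r f implication = em⇒dne em λ ¬holds → implication
    ( Sat-Gₗ-intro prophecyConstraint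
        (λ { zero () ; (suc j) _ → prophecyConstraint-holds isP r f j })
    , λ lifted → ¬holds (to (Sat-liftAP r ψ 0) lifted))

theorem3 : ExcludedMiddle 0ℓ →
    {AP : Set} (K : Kripke AP) → FiniteKripke K →
    (n : ℕ) (ψ : LTL (AP × Fin (double n))) →
    (Ξ : ProphecyFamily AP n) → IsProphecyFamily Ξ →
    (m : ℕ) (pv : LTL (AP × Fin (double n)) → Fin m) → IsProphecyVars Ξ pv →
    (K ⊨ altFormula n ψ) ⇔ (KP K m ⊨ prophecyFormula Ξ pv ψ)
theorem3 em K _ n ψ Ξ isΞ m pv isP = mk⇔
  (QSat-toKP K m n λ r holds (_ , ¬lifted) → ¬lifted (from (Sat-liftAP r ψ 0) holds))
  (QSat-fromKP K m n (prophecyOracle em Ξ pv) (prophecyOracle-causal em Ξ pv isΞ)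
    (prophecyFormula-fromKP em Ξ pv isP ψ))
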